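{- Let $q$ be an odd prime power with $q\ge5$, let $n\ge2$ with $q\equiv1\pmod{2n}$, and let $a,b\in\mathbb{F}_q^*$ with $a$ of multiplicative order $2n$. Put $z_i=ba^{i-1}$ and $x_i=(z_i-b)/(a+1)$ for $1\le i\le n$, and $\mathbf{O}_n=\{x_1,\ldots,x_n\}$. Let $F:\mathbb{F}_q\to\mathbb{F}_q$ be defined by $F(\delta)=(a+1)\delta+b$ for $\delta\notin\mathbf{O}_n$, $F(x_i)=ax_{i-1}+x_i+b$ for $2\le i\le n$, and $F(x_1)=0$. Then $|V_F|\ge q-n$, and every element of $\mathbb{F}_q$ has at most $2$ preimages under $F$.
   Context: $V_F=\{F(c):c\in\mathbb{F}_q\}$ denotes the value set of $F$. (Here $x_1=0$ and $x_n=-b/a$, and $F=f+x$ where $f$ is the permutation with $f=g$ off $\mathbf{O}_n$, $f(x_i)=g(x_{i-1})$ for $i\ge2$, $f(x_1)=g(x_n)=0$, $g(x)=ax+b$.) -}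

module Defs where

open import Level using (Level; _⊔_) renaming (suc to lsuc)
open import Data.Nat using (ℕ; zero; suc; _≤_; _∸_)
open import Data.Fin using (Fin)
open import Data.Maybe using (Maybe; just; nothing)
open import Data.Product using (Σ; ∃; _×_; _,_)
open import Relation.Nullary using (Dec; yes; no; ¬_)
open import Relation.Binary.PropositionalEquality using (_≡_)
open import Algebra.Bundles using (CommutativeRing)

-- A finite field with exactly q elements:
-- a commutative ring with 1 ≠ 0, decidable equality, an inverse operation
-- (0⁻¹ is an arbitrary junk value, as in Mathlib), and an enumeration
-- Fin q → Carrier that is a bijection up to the setoid equality ≈.
record FiniteField (c ℓ : Level) (q : ℕ) : Set (lsuc (c ⊔ ℓ)) where
  field
    commRing : CommutativeRing c ℓ
  open CommutativeRing commRing public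
  field
    _≟_      : (x y : Carrier) → Dec (x ≈ y)
    1≉0      : ¬ (1# ≈ 0#)
    _⁻¹      : Carrier → Carrier
    ⁻¹-inv   : (x : Carrier) → ¬ (x ≈ 0#) → (x * (x ⁻¹)) ≈ 1#
    enum     : Fin q → Carrier
    enum-inj : (i j : Fin q) → enum i ≈ enum j → i ≡ j
    enum-surj : (x : Carrier) → ∃ λ i → enum i ≈ x

open import Data.Nat.Primality using (Prime)
open import Data.Nat using (_^_)

IsPrimePower : ℕ → Set
IsPrimePower q = Σ ℕ λ p → Σ ℕ λ k → Prime p × (1 ≤ k) × (q ≡ p ^ k)

module Construction {c ℓ : Level} {q : ℕ} (K : FiniteField c ℓ q) where
  open FiniteField K

  pow : Carrier → ℕ → Carrier
  pow x zero    = 1#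
  pow x (suc k) = x * pow x k

  HasOrder : Carrier → ℕ → Set ℓ
  HasOrder x m = pow x m ≈ 1# × ((k : ℕ) → 1 ≤ k → suc k ≤ m → ¬ (pow x k ≈ 1#))

  module _ (a b : Carrier) (n : ℕ) where
    z : ℕ → Carrier
    z i = b * pow a (i ∸ 1)

    x : ℕ → Carrier
    x i = (z i - b) * ((a + 1#) ⁻¹)

    _∈O : Carrier → Set ℓ
    δ ∈O = Σ ℕ λ i → (1 ≤ i) × (i ≤ n) × (δ ≈ x i)

    search : ℕ → Carrier → Maybe ℕ
    search zero    δ = nothing
    search (suc k) δ with δ ≟ x (suc k)
    ... | yes _ = just (suc k)
    ... | no  _ = search k δ

    -- F(δ) = (a+1)δ + b for δ ∉ O_n,
    -- F(x_i) = a x_{i-1} + x_i + b for 2 ≤ i ≤ n,  F(x_1) = 0.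
    -- (the `just zero` branch is unreachable)
    F : Carrier → Carrier
    F δ with search n δ
    ... | nothing            = (a + 1#) * δ + b
    ... | just zero          = 0#
    ... | just (suc zero)    = 0#
    ... | just (suc (suc j)) = a * x (suc j) + x (suc (suc j)) + b

    ValueSetAtLeast : ℕ → Set (c ⊔ ℓ)
    ValueSetAtLeast m =
      Σ (Fin m → Carrier) λ v →
        ((i j : Fin m) → v i ≈ v j → i ≡ j) × ((i : Fin m) → ∃ λ δ → F δ ≈ v i)

    AtMostTwoPreimages : Set (c ⊔ ℓ)
    AtMostTwoPreimages = (y d₁ d₂ d₃ : Carrier) →
      F d₁ ≈ y → F d₂ ≈ y → F d₃ ≈ y →
      (d₁ ≈ d₂) ⊎′ ((d₁ ≈ d₃) ⊎′ (d₂ ≈ d₃))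
      where open import Data.Sum using () renaming (_⊎_ to _⊎′_)

-- Off O_n the map F is the bijective affine map δ ↦ (a+1)δ + b, which sends x_i to z_i; so F
-- takes every value outside {z_1,…,z_n} at a point off O_n, and at most once there.  On O_n,
-- (a+1)F(x_i) = a z_{i-1} + z_i = 2 z_i for i ≥ 2 while F(x_1) = 0, so F is injective on O_n
-- because z_2,…,z_n are distinct and nonzero.  Hence every value has at most one preimage on each
-- side.
module Submission where

open import Defs
open import Level using (Level)
open import Data.Nat as ℕ using (ℕ; zero; suc; z≤n; s≤s; pred; _≤_; _<_)
import Data.Nat.Properties as ℕ
open import Data.Fin as Fin using (Fin; punchIn)
import Data.Fin.Properties as Fin
open import Data.Product using (Σ; ∃; _×_; _,_; proj₁; proj₂)
open import Data.Sum using (_⊎_; inj₁; inj₂)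
open import Data.Bool using (Bool; true; false)
open import Data.Maybe using (just; nothing)
open import Data.Empty using (⊥-elim)
open import Function using (_∘_)
open import Function.Definitions using (Injective)
open import Relation.Nullary using (¬_; yes; no)
open import Relation.Binary using (Setoid; Decidable; tri<; tri≈; tri>)
open import Relation.Binary.PropositionalEquality using (_≡_)
import Relation.Binary.PropositionalEquality as ≡

two-of-three : (u v w : Bool) → u ≡ v ⊎ (u ≡ w ⊎ v ≡ w)
two-of-three false false _     = inj₁ ≡.refl
two-of-three true  true  _     = inj₁ ≡.refl
two-of-three false true  false = inj₂ (inj₁ ≡.refl)
two-of-three true  false true  = inj₂ (inj₁ ≡.refl)
two-of-three false true  true  = inj₂ (inj₂ ≡.refl)
two-of-three true  false false = inj₂ (inj₂ ≡.refl)

module FieldProperties {c ℓ q} (K : FiniteField c ℓ q) where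
  open FiniteField K hiding (zero)
  open import Algebra.Definitions _≈_ using (AlmostLeftCancellative)

  *-cancelˡ-nonzero : AlmostLeftCancellative 0# _*_
  *-cancelˡ-nonzero s u v s≉0 su≈sv = begin
    u                ≈⟨ *-identityˡ u ⟨
    1# * u           ≈⟨ *-congʳ s⁻¹s≈1 ⟨
    (s ⁻¹ * s) * u   ≈⟨ *-assoc _ _ _ ⟩
    s ⁻¹ * (s * u)   ≈⟨ *-congˡ su≈sv ⟩
    s ⁻¹ * (s * v)   ≈⟨ *-assoc _ _ _ ⟨
    (s ⁻¹ * s) * v   ≈⟨ *-congʳ s⁻¹s≈1 ⟩
    1# * v           ≈⟨ *-identityˡ v ⟩
    v                ∎
    where
    open import Relation.Binary.Reasoning.Setoid setoid
    s⁻¹s≈1 : s ⁻¹ * s ≈ 1#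
    s⁻¹s≈1 = trans (*-comm _ _) (⁻¹-inv s s≉0)

  *-nonzero : ∀ {s u} → ¬ s ≈ 0# → ¬ u ≈ 0# → ¬ s * u ≈ 0#
  *-nonzero {s} {u} s≉0 u≉0 su≈0 =
    u≉0 (*-cancelˡ-nonzero s u 0# s≉0 (trans su≈0 (sym (zeroʳ s))))

  x²≈0⇒x≈0 : ∀ s → s * s ≈ 0# → s ≈ 0#
  x²≈0⇒x≈0 s s²≈0 with s ≟ 0#
  ... | yes s≈0 = s≈0
  ... | no  s≉0 = ⊥-elim (*-nonzero s≉0 s≉0 s²≈0)

module Powers {c ℓ q} (K : FiniteField c ℓ q) where
  open FiniteField K hiding (zero)
  open Construction K using (pow; HasOrder)
  open FieldProperties K
  open import Algebra.Properties.Group +-group using (inverseˡ-unique; ⁻¹-involutive)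
  open import Algebra.Properties.Ring ring using (-1*x≈-x)
  open import Algebra.Solver.Ring.NaturalCoefficients.Default commutativeSemiring
    using (solve; _:+_; _:*_; _:=_; con)
  open import Relation.Binary.Reasoning.Setoid setoid

  pow-+ : ∀ s i j → pow s (i ℕ.+ j) ≈ pow s i * pow s j
  pow-+ s zero    j = sym (*-identityˡ _)
  pow-+ s (suc i) j = trans (*-congˡ (pow-+ s i j)) (sym (*-assoc _ _ _))

  pow-nonzero : ∀ {s} → ¬ s ≈ 0# → ∀ i → ¬ pow s i ≈ 0#
  pow-nonzero s≉0 zero    = 1≉0
  pow-nonzero s≉0 (suc i) = *-nonzero s≉0 (pow-nonzero s≉0 i)

  module _ {s m} (s≉0 : ¬ s ≈ 0#) (ord : HasOrder s m) where

    pow-distinct : ∀ {i j} → i < j → j < m → ¬ pow s i ≈ pow s j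
    pow-distinct {i} {j} i<j j<m sⁱ≈sʲ with ℕ.m≤n⇒∃[o]m+o≡n i<j
    ... | d , ≡.refl = proj₂ ord (suc d) (s≤s z≤n) sᵈ⁺¹<m sᵈ⁺¹≈1
      where
      sᵈ⁺¹<m : suc d < m
      sᵈ⁺¹<m = ℕ.≤-<-trans (ℕ.m≤m+n (suc d) i) (≡.subst (_< m) (≡.cong suc (ℕ.+-comm i d)) j<m)
      sᵈ⁺¹≈1 : pow s (suc d) ≈ 1#
      sᵈ⁺¹≈1 = *-cancelˡ-nonzero (pow s i) _ _ (pow-nonzero s≉0 i) (begin
        pow s i * pow s (suc d)  ≈⟨ pow-+ s i (suc d) ⟨
        pow s (i ℕ.+ suc d)        ≡⟨ ≡.cong (pow s) (ℕ.+-suc i d) ⟩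
        pow s (suc i ℕ.+ d)        ≈⟨ sⁱ≈sʲ ⟨
        pow s i                  ≈⟨ *-identityʳ _ ⟨
        pow s i * 1#             ∎)

    pow-injective : ∀ {i j} → i < m → j < m → pow s i ≈ pow s j → i ≡ j
    pow-injective {i} {j} i<m j<m sⁱ≈sʲ with ℕ.<-cmp i j
    ... | tri< i<j _ _ = ⊥-elim (pow-distinct i<j j<m sⁱ≈sʲ)
    ... | tri≈ _ i≡j _ = i≡j
    ... | tri> _ _ j<i = ⊥-elim (pow-distinct j<i i<m (sym sⁱ≈sʲ))

  +1≉0 : ∀ {s m} → HasOrder s m → 3 ≤ m → ¬ s + 1# ≈ 0#
  +1≉0 {s} ord 3≤m s+1≈0 = proj₂ ord 2 (s≤s z≤n) 3≤m (begin
    s * (s * 1#)        ≈⟨ *-congˡ (*-identityʳ s) ⟩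
    s * s               ≈⟨ *-cong s≈-1 s≈-1 ⟩
    - 1# * - 1#         ≈⟨ -1*x≈-x (- 1#) ⟩
    - - 1#              ≈⟨ ⁻¹-involutive 1# ⟩
    1#                  ∎)
    where
    s≈-1 : s ≈ - 1#
    s≈-1 = inverseˡ-unique s 1# s+1≈0

  -- Were 1 + 1 = 0, the square root t = sⁿ of 1 would satisfy (t + 1)² = 2(t + 1) = 0, so t = -1 = 1.
  1+1≉0 : ∀ {s n} → HasOrder s (2 ℕ.* n) → 1 ≤ n → ¬ 1# + 1# ≈ 0#
  1+1≉0 {s} {n} ord 1≤n 2≈0 = proj₂ ord n 1≤n n<2n t≈1
    where
    n<2n : n < 2 ℕ.* n
    n<2n = ≡.subst (n <_) (≡.cong (n ℕ.+_) (≡.sym (ℕ.+-identityʳ n))) (ℕ.m<m+n n 1≤n)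
    t = pow s n
    t²≈1 : t * t ≈ 1#
    t²≈1 = begin
      t * t               ≡⟨ ≡.cong (λ k → t * pow s k) (ℕ.+-identityʳ n) ⟨
      t * pow s (n ℕ.+ 0)   ≈⟨ pow-+ s n (n ℕ.+ 0) ⟨
      pow s (2 ℕ.* n)       ≈⟨ proj₁ ord ⟩
      1#                  ∎
    [t+1]²≈0 : (t + 1#) * (t + 1#) ≈ 0#
    [t+1]²≈0 = begin
      (t + 1#) * (t + 1#)      ≈⟨ solve 1 (λ t → (t :+ con 1) :* (t :+ con 1)
                                   := t :* t :+ con 1 :+ (con 1 :+ con 1) :* t) refl t ⟩
      t * t + 1# + (1# + 1#) * t ≈⟨ +-congʳ (+-congʳ t²≈1) ⟩
      1# + 1# + (1# + 1#) * t  ≈⟨ solve 1 (λ t → con 1 :+ con 1 :+ (con 1 :+ con 1) :* t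
                                   := (con 1 :+ con 1) :* (t :+ con 1)) refl t ⟩
      (1# + 1#) * (t + 1#)     ≈⟨ *-congʳ 2≈0 ⟩
      0# * (t + 1#)            ≈⟨ zeroˡ _ ⟩
      0#                       ∎
    t≈1 : t ≈ 1#
    t≈1 = begin
      t      ≈⟨ inverseˡ-unique t 1# (x²≈0⇒x≈0 _ [t+1]²≈0) ⟩
      - 1#   ≈⟨ inverseˡ-unique 1# 1# 2≈0 ⟨
      1#     ∎

module Avoiding {a ℓ} (S : Setoid a ℓ) (_≟_ : Decidable (Setoid._≈_ S)) where
  open Setoid S renaming (Carrier to A)

  remove : ∀ {m} (e : Fin m → A) → Injective _≡_ _≈_ e → (y : A) →
    Σ (Fin (pred m) → Fin m) λ σ → Injective _≡_ _≈_ (e ∘ σ) × (∀ i → ¬ e (σ i) ≈ y)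
  remove {zero}  e e-inj y = (λ ()) , (λ {}) , (λ ())
  remove {suc m} e e-inj y with Fin.any? (λ p → e p ≟ y)
  ... | yes (p , eₚ≈y) = punchIn p , Fin.punchIn-injective p _ _ ∘ e-inj ,
                         λ i eᵢ≈y → Fin.punchInᵢ≢i p i (e-inj (trans eᵢ≈y (sym eₚ≈y)))
  ... | no  y∉e        = Fin.suc , Fin.suc-injective ∘ e-inj , λ i eᵢ≈y → y∉e (Fin.suc i , eᵢ≈y)

  Avoids : ∀ {m} → (ℕ → A) → ℕ → (Fin m → A) → Set ℓ
  Avoids z k e = ∀ i {j} → 1 ≤ j → j ≤ k → ¬ e i ≈ z j

  avoiding : ∀ {m} (e : Fin m → A) → Injective _≡_ _≈_ e → (z : ℕ → A) → ∀ k →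
    Σ (Fin (m ℕ.∸ k) → A) λ e′ → Injective _≡_ _≈_ e′ × Avoids z k e′
  avoiding e e-inj z zero = e , e-inj , λ _ 1≤j j≤0 → ⊥-elim (ℕ.<⇒≱ 1≤j j≤0)
  avoiding {m} e e-inj z (suc k) with avoiding e e-inj z k
  ... | e′ , e′-inj , e′-avoids with remove e′ e′-inj (z (suc k))
  ...   | σ , σ-inj , σ-avoids =
    ≡.subst (λ l → Σ (Fin l → A) λ e″ → Injective _≡_ _≈_ e″ × Avoids z (suc k) e″)
      (ℕ.pred[m∸n]≡m∸[1+n] m k) (e′ ∘ σ , σ-inj , avoids)
    where
    avoids : Avoids z (suc k) (e′ ∘ σ)
    avoids i {j} 1≤j j≤k+1 with ℕ.m≤n⇒m<n∨m≡n j≤k+1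
    ... | inj₁ (s≤s j≤k) = e′-avoids (σ i) 1≤j j≤k
    ... | inj₂ ≡.refl    = σ-avoids i

module Theorem9 {c ℓ q} (K : FiniteField c ℓ q) (n : ℕ) (2≤n : 2 ≤ n)
  (a b : FiniteField.Carrier K)
  (a≉0 : ¬ FiniteField._≈_ K a (FiniteField.0# K))
  (b≉0 : ¬ FiniteField._≈_ K b (FiniteField.0# K))
  (ord : Construction.HasOrder K a (2 ℕ.* n)) where

  open FiniteField K hiding (zero)
  open Construction K
  open FieldProperties K
  open Powers K
  open Avoiding setoid _≟_ using (avoiding)
  open import Algebra.Properties.Group +-group using (//-rightDividesˡ; ∙-cancelʳ)
  open import Algebra.Solver.Ring.NaturalCoefficients.Default commutativeSemiring
    using (solve; _:+_; _:*_; _:=_; con)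
  open import Relation.Binary.Reasoning.Setoid setoid

  z[_] x[_] : ℕ → Carrier
  z[_] = z a b n
  x[_] = x a b n

  a+1≉0 : ¬ a + 1# ≈ 0#
  a+1≉0 = +1≉0 ord (ℕ.≤-trans (ℕ.n≤1+n 3) (ℕ.*-monoʳ-≤ 2 2≤n))

  2≉0 : ¬ 1# + 1# ≈ 0#
  2≉0 = 1+1≉0 ord (ℕ.≤-trans (s≤s z≤n) 2≤n)

  -- x_j is definitionally affine⁻¹ z_j; the proofs below rely on this silently.
  affine affine⁻¹ : Carrier → Carrier
  affine   δ = (a + 1#) * δ + b
  affine⁻¹ y = (y - b) * (a + 1#) ⁻¹

  affine-injective : ∀ {δ δ′} → affine δ ≈ affine δ′ → δ ≈ δ′
  affine-injective {δ} {δ′} eq = *-cancelˡ-nonzero _ δ δ′ a+1≉0 (∙-cancelʳ b _ _ eq)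

  affine∘affine⁻¹ : ∀ y → affine (affine⁻¹ y) ≈ y
  affine∘affine⁻¹ y = begin
    (a + 1#) * ((y - b) * (a + 1#) ⁻¹) + b  ≈⟨ +-congʳ (solve 3 (λ s u v → s :* (u :* v) := u :* (s :* v))
                                                 refl (a + 1#) (y - b) ((a + 1#) ⁻¹)) ⟩
    (y - b) * ((a + 1#) * (a + 1#) ⁻¹) + b  ≈⟨ +-congʳ (*-congˡ (⁻¹-inv _ a+1≉0)) ⟩
    (y - b) * 1# + b                        ≈⟨ +-congʳ (*-identityʳ _) ⟩
    (y - b) + b                             ≈⟨ //-rightDividesˡ b y ⟩
    y                                       ∎

  -- The value of F at x_j; index 0 is never used.
  F-at-x : ℕ → Carrier
  F-at-x zero          = 0#
  F-at-x (suc zero)    = 0#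
  F-at-x (suc (suc j)) = a * x[ suc j ] + x[ suc (suc j) ] + b

  [a+1]*F-at-x : ∀ k → (a + 1#) * F-at-x (suc (suc k)) ≈ (1# + 1#) * z[ suc (suc k) ]
  [a+1]*F-at-x k = begin
    (a + 1#) * (a * x₁ + x₂ + b)
      ≈⟨ solve 4 (λ A u v B → (A :+ con 1) :* (A :* u :+ v :+ B)
                   := A :* ((A :+ con 1) :* u :+ B) :+ ((A :+ con 1) :* v :+ B)) refl a x₁ x₂ b ⟩
    a * affine x₁ + affine x₂      ≈⟨ +-cong (*-congˡ (affine∘affine⁻¹ _)) (affine∘affine⁻¹ _) ⟩
    a * (b * pow a k) + b * (a * pow a k)
      ≈⟨ solve 3 (λ A B P → A :* (B :* P) :+ B :* (A :* P) := (con 1 :+ con 1) :* (B :* (A :* P)))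
           refl a b (pow a k) ⟩
    (1# + 1#) * (b * pow a (suc k)) ∎
    where
    x₁ = x[ suc k ]
    x₂ = x[ suc (suc k) ]

  F-at-x-nonzero : ∀ k → ¬ F-at-x (suc (suc k)) ≈ 0#
  F-at-x-nonzero k F≈0 =
    *-nonzero 2≉0 (*-nonzero b≉0 (pow-nonzero a≉0 (suc k)))
      (trans (sym ([a+1]*F-at-x k)) (trans (*-congˡ F≈0) (zeroʳ _)))

  F-at-x-injective : ∀ {i j} → 1 ≤ i → i ≤ n → 1 ≤ j → j ≤ n → F-at-x i ≈ F-at-x j → i ≡ j
  F-at-x-injective {suc zero}    {suc zero}    _ _   _ _   _  = ≡.refl
  F-at-x-injective {suc zero}    {suc (suc l)} _ _   _ _   eq = ⊥-elim (F-at-x-nonzero l (sym eq))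
  F-at-x-injective {suc (suc k)} {suc zero}    _ _   _ _   eq = ⊥-elim (F-at-x-nonzero k eq)
  F-at-x-injective {suc (suc k)} {suc (suc l)} _ i≤n _ j≤n eq =
    ≡.cong suc (pow-injective a≉0 ord (below-2n i≤n) (below-2n j≤n)
      (*-cancelˡ-nonzero b _ _ b≉0 (*-cancelˡ-nonzero (1# + 1#) _ _ 2≉0
        (trans (sym ([a+1]*F-at-x k)) (trans (*-congˡ eq) ([a+1]*F-at-x l))))))
    where
    below-2n : ∀ {i} → suc i ≤ n → i < 2 ℕ.* n
    below-2n i<n = ℕ.<-≤-trans i<n (ℕ.m≤n*m n 2)

  search-just : ∀ k δ {j} → search a b n k δ ≡ just j → 1 ≤ j × j ≤ k × δ ≈ x[ j ]
  search-just (suc k) δ eq with δ ≟ x[ suc k ]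
  search-just (suc k) δ ≡.refl | yes δ≈x = s≤s z≤n , ℕ.≤-refl , δ≈x
  search-just (suc k) δ eq     | no  _ with search-just k δ eq
  ... | 1≤j , j≤k , δ≈x = 1≤j , ℕ.m≤n⇒m≤1+n j≤k , δ≈x

  data Position (δ : Carrier) : Set ℓ where
    off-O : F a b n δ ≈ affine δ → Position δ
    on-O  : ∀ j → 1 ≤ j → j ≤ n → δ ≈ x[ j ] → F a b n δ ≈ F-at-x j → Position δ

  F≈affine : ∀ δ → search a b n n δ ≡ nothing → F a b n δ ≈ affine δ
  F≈affine δ eq with search a b n n δ
  F≈affine δ ≡.refl | nothing = refl

  F≈F-at-x : ∀ δ {j} → search a b n n δ ≡ just j → F a b n δ ≈ F-at-x j
  F≈F-at-x δ eq with search a b n n δ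
  F≈F-at-x δ ≡.refl | just zero          = refl
  F≈F-at-x δ ≡.refl | just (suc zero)    = refl
  F≈F-at-x δ ≡.refl | just (suc (suc k)) = refl

  position : ∀ δ → Position δ
  position δ with search a b n n δ in eq
  ... | nothing = off-O (F≈affine δ eq)
  ... | just j with search-just n δ eq
  ...   | 1≤j , j≤n , δ≈x = on-O j 1≤j j≤n δ≈x (F≈F-at-x δ eq)

  side : ∀ {δ} → Position δ → Bool
  side (off-O _)        = false
  side (on-O _ _ _ _ _) = true

  same-side-injective : ∀ {d d′} (p : Position d) (p′ : Position d′) →
    side p ≡ side p′ → F a b n d ≈ F a b n d′ → d ≈ d′
  same-side-injective (off-O Fd≈) (off-O Fd′≈) _ Fd≈Fd′ =
    affine-injective (trans (sym Fd≈) (trans Fd≈Fd′ Fd′≈))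
  same-side-injective (on-O i 1≤i i≤n d≈xᵢ Fd≈) (on-O j 1≤j j≤n d′≈xⱼ Fd′≈) _ Fd≈Fd′
    with F-at-x-injective 1≤i i≤n 1≤j j≤n (trans (sym Fd≈) (trans Fd≈Fd′ Fd′≈))
  ... | ≡.refl = trans d≈xᵢ (sym d′≈xⱼ)

  value-outside-z : ∀ y → (∀ {j} → 1 ≤ j → j ≤ n → ¬ y ≈ z[ j ]) → ∃ λ δ → F a b n δ ≈ y
  value-outside-z y y∉z with position (affine⁻¹ y)
  ... | off-O Fδ≈ = affine⁻¹ y , trans Fδ≈ (affine∘affine⁻¹ y)
  ... | on-O j 1≤j j≤n δ≈xⱼ _ = ⊥-elim (y∉z 1≤j j≤n (begin
    y                   ≈⟨ affine∘affine⁻¹ y ⟨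
    affine (affine⁻¹ y) ≈⟨ +-congʳ (*-congˡ δ≈xⱼ) ⟩
    affine x[ j ]       ≈⟨ affine∘affine⁻¹ z[ j ] ⟩
    z[ j ]              ∎))

  value-set : ValueSetAtLeast a b n (q ℕ.∸ n)
  value-set with avoiding enum (enum-inj _ _) z[_] n
  ... | e , e-inj , e-avoids = e , (λ _ _ → e-inj) , λ i → value-outside-z (e i) (e-avoids i)

  at-most-two-preimages : AtMostTwoPreimages a b n
  at-most-two-preimages y d₁ d₂ d₃ F₁ F₂ F₃
    with p₁ ← position d₁ | p₂ ← position d₂ | p₃ ← position d₃
    with two-of-three (side p₁) (side p₂) (side p₃)
  ... | inj₁ s₁₂        = inj₁ (same-side-injective p₁ p₂ s₁₂ (trans F₁ (sym F₂)))
  ... | inj₂ (inj₁ s₁₃) = inj₂ (inj₁ (same-side-injective p₁ p₃ s₁₃ (trans F₁ (sym F₃))))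
  ... | inj₂ (inj₂ s₂₃) = inj₂ (inj₂ (same-side-injective p₂ p₃ s₂₃ (trans F₂ (sym F₃))))

-- Opened only here, since ℕ's _*_ would clash with the field multiplication above.
open import Data.Nat using (_*_; _∸_; _%_)
open import Data.Nat.Divisibility using (_∣_)

theorem9 : {c ℓ : Level} (q : ℕ) (K : FiniteField c ℓ q) →
    IsPrimePower q → q % 2 ≡ 1 → 5 ≤ q →
    (n : ℕ) → 2 ≤ n → (2 * n) ∣ (q ∸ 1) →
    (a b : FiniteField.Carrier K) →
    ¬ (FiniteField._≈_ K a (FiniteField.0# K)) →
    ¬ (FiniteField._≈_ K b (FiniteField.0# K)) →
    Construction.HasOrder K a (2 * n) →
    Construction.ValueSetAtLeast K a b n (q ∸ n)
      × Construction.AtMostTwoPreimages K a b n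
theorem9 q K _ _ _ n 2≤n _ a b a≉0 b≉0 ord = value-set , at-most-two-preimages
  where open Theorem9 K n 2≤n a b a≉0 b≉0 ord
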